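{- Let $S[1..n]$ be a string. For any $i,j,x,y$ with $1\le i<j\le x\le y\le n$: if $\mathrm{LLR}_j$ does not exist, or exists but does not cover the interval $[x..y]$, then $\mathrm{LLR}_i$ does not exist or does not cover $[x..y]$.
   Context: $S[i..j]=S[i]\cdots S[j]$. A substring $S[i..j]$ covers $[x..y]$ if $i\le x\le y\le j$. A substring $S[i..j]$ is unique if there is no other substring $S[i'..j']$ with $S[i'..j']=S[i..j]$ and $i'\ne i$; a repeat is a non-unique substring. The left-bounded longest repeat starting at position $k$, $\mathrm{LLR}_k$, is a repeat $S[k..j]$ such that either $j=n$ or $S[k..j+1]$ is unique; it does not exist if $S[k]$ (as a one-character substring) is unique. -}

module Defs where

open import Data.Nat using (ℕ; suc; _+_; _∸_; _≤_; _<_)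
open import Data.Product using (_×_; Σ)
open import Data.Sum using (_⊎_)
open import Relation.Binary.PropositionalEquality using (_≡_; _≢_)
open import Relation.Nullary using (¬_)

-- A string S[1..n] over an alphabet A is given by its length n and a
-- function S : ℕ → A; only positions 1..n are ever consulted.
module _ {A : Set} (n : ℕ) (S : ℕ → A) where

  Valid : ℕ → ℕ → Set
  Valid i j = 1 ≤ i × i ≤ j × j ≤ n

  SameStr : ℕ → ℕ → ℕ → ℕ → Set
  SameStr i j i' j' = (j' ∸ i' ≡ j ∸ i) × (∀ k → k ≤ j ∸ i → S (i + k) ≡ S (i' + k))

  Unique : ℕ → ℕ → Set
  Unique i j = ¬ (Σ ℕ λ i' → Σ ℕ λ j' → Valid i' j' × SameStr i j i' j' × i' ≢ i)

  Repeat : ℕ → ℕ → Set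
  Repeat i j = Valid i j × ¬ Unique i j

  -- LLR k j : S[k..j] is the left-bounded longest repeat starting at k
  LLR : ℕ → ℕ → Set
  LLR k j = Repeat k j × (j ≡ n ⊎ Unique k (suc j))

  Covers : ℕ → ℕ → ℕ → ℕ → Set
  Covers i j x y = i ≤ x × x ≤ y × y ≤ j

  NotCoveredByLLR : ℕ → ℕ → ℕ → Set
  NotCoveredByLLR k x y = ∀ e → LLR k e → ¬ Covers k e x y

module Submission where

-- If LLR_i = S[i..e] exists and covers [x..y], then i < j ≤ x ≤ y ≤ e, so
-- S[j..e] is a suffix of the repeat S[i..e]; shifting every other occurrence
-- of S[i..e] by j - i gives another occurrence of S[j..e], hence S[j..e] is
-- a repeat as well.  A repeat S[j..e] can always be prolonged to a
-- left-bounded longest repeat S[j..e'] with e ≤ e' (extend to the right while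
-- the string stays a repeat; we stop at the latest at position n).  Since
-- y ≤ e ≤ e', that LLR_j covers [x..y], contradicting the hypothesis on j.

open import Defs
open import Data.Nat using (ℕ; suc; _+_; _∸_; _≤_; _<_)
open import Data.Nat.Properties
  using (≤-refl; ≤-trans; <⇒≤; n≤1+n; m≤m+n; m≤n⇒∃[o]m+o≡n; +-assoc; +-suc; +-cancelʳ-≡;
         +-monoʳ-≤; +-identityʳ; m+[n∸m]≡n; m+n∸m≡n)
open import Data.Product using (Σ; _×_; _,_)
open import Data.Sum using (inj₁; inj₂)
open import Relation.Binary.PropositionalEquality
  using (_≡_; _≢_; refl; sym; trans; cong; subst; module ≡-Reasoning)
open import Relation.Nullary using (¬_)

module _ {A : Set} (n : ℕ) (S : ℕ → A) where

  OtherOccurrence : ℕ → ℕ → Set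
  OtherOccurrence i j =
    Σ ℕ λ i' → Σ ℕ λ j' → Valid n S i' j' × SameStr n S i j i' j' × i' ≢ i

  suffix-occurrence : ∀ i d r →
    OtherOccurrence i (i + d + r) → OtherOccurrence (i + d) (i + d + r)
  suffix-occurrence i d r (i' , e' , (1≤i' , i'≤e' , e'≤n) , (len , same) , i'≢i) =
    i' + d , e' , (≤-trans 1≤i' (m≤m+n i' d) , start≤end , e'≤n) ,
    (len-suffix , same-suffix) , λ eq → i'≢i (+-cancelʳ-≡ d i' i eq)
    where
      open ≡-Reasoning

      span : i + d + r ∸ i ≡ d + r
      span = trans (cong (_∸ i) (+-assoc i d r)) (m+n∸m≡n i (d + r))

      end : e' ≡ i' + d + r
      end = begin
        e'                 ≡⟨ sym (m+[n∸m]≡n i'≤e') ⟩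
        i' + (e' ∸ i')     ≡⟨ cong (i' +_) (trans len span) ⟩
        i' + (d + r)       ≡⟨ sym (+-assoc i' d r) ⟩
        i' + d + r         ∎

      start≤end : i' + d ≤ e'
      start≤end = subst (i' + d ≤_) (sym end) (m≤m+n (i' + d) r)

      len-suffix : e' ∸ (i' + d) ≡ i + d + r ∸ (i + d)
      len-suffix = begin
        e' ∸ (i' + d)           ≡⟨ cong (_∸ (i' + d)) end ⟩
        i' + d + r ∸ (i' + d)   ≡⟨ m+n∸m≡n (i' + d) r ⟩
        r                       ≡⟨ sym (m+n∸m≡n (i + d) r) ⟩
        i + d + r ∸ (i + d)     ∎

      same-suffix : ∀ k → k ≤ i + d + r ∸ (i + d) → S (i + d + k) ≡ S (i' + d + k)
      same-suffix k k≤ = begin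
        S (i + d + k)     ≡⟨ cong S (+-assoc i d k) ⟩
        S (i + (d + k))   ≡⟨ same (d + k) d+k≤span ⟩
        S (i' + (d + k))  ≡⟨ cong S (sym (+-assoc i' d k)) ⟩
        S (i' + d + k)    ∎
        where
          d+k≤span : d + k ≤ i + d + r ∸ i
          d+k≤span = subst (d + k ≤_) (sym span)
                       (+-monoʳ-≤ d (subst (k ≤_) (m+n∸m≡n (i + d) r) k≤))

  repeat-suffix : ∀ {i j e} → 1 ≤ i → i ≤ j → j ≤ e → Repeat n S i e → Repeat n S j e
  repeat-suffix {i} 1≤i i≤j j≤e ((_ , _ , e≤n) , not-unique)
    with m≤n⇒∃[o]m+o≡n i≤j | m≤n⇒∃[o]m+o≡n j≤e
  ... | d , refl | r , refl =
    (≤-trans 1≤i i≤j , j≤e , e≤n) ,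
    λ unique-suffix → not-unique λ occ → unique-suffix (suffix-occurrence i d r occ)

  -- Every repeat S[j..e] extends to a left-bounded longest repeat S[j..e']
  -- with e ≤ e'; stated as: if no such LLR_j exists, S[j..e] is no repeat.
  repeat-extends : ∀ {j e} → (∀ e' → e ≤ e' → ¬ LLR n S j e') → ¬ Repeat n S j e
  repeat-extends {j} {e} no-llr rep@((_ , _ , e≤n) , _) with m≤n⇒∃[o]m+o≡n e≤n
  ... | k , e+k≡n = prolong k e e+k≡n no-llr rep
    where
      prolong : ∀ k e → e + k ≡ n →
                (∀ e' → e ≤ e' → ¬ LLR n S j e') → ¬ Repeat n S j e
      prolong 0 e e+0≡n no-llr rep =
        no-llr e ≤-refl (rep , inj₁ (trans (sym (+-identityʳ e)) e+0≡n))
      prolong (suc k) e e+k≡n no-llr rep@((1≤j , j≤e , _) , _) =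
        prolong k (suc e) e+1+k≡n
          (λ e' 1+e≤e' → no-llr e' (≤-trans (n≤1+n e) 1+e≤e'))
          ((1≤j , ≤-trans j≤e (n≤1+n e) , subst (suc e ≤_) e+1+k≡n (m≤m+n (suc e) k)) ,
           λ unique → no-llr e ≤-refl (rep , inj₂ unique))
        where
          e+1+k≡n : suc e + k ≡ n
          e+1+k≡n = trans (sym (+-suc e k)) e+k≡n

lemma4 : {A : Set} (n : ℕ) (S : ℕ → A) (i j x y : ℕ) →
    1 ≤ i → i < j → j ≤ x → x ≤ y → y ≤ n →
    NotCoveredByLLR n S j x y → NotCoveredByLLR n S i x y
lemma4 n S i j x y 1≤i i<j j≤x x≤y _ not-covered-j e (rep-i , _) (_ , _ , y≤e) =
  repeat-extends n S no-covering-llr-j rep-j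
  where
    j≤e : j ≤ e
    j≤e = ≤-trans j≤x (≤-trans x≤y y≤e)

    rep-j : Repeat n S j e
    rep-j = repeat-suffix n S 1≤i (<⇒≤ i<j) j≤e rep-i

    no-covering-llr-j : ∀ e' → e ≤ e' → ¬ LLR n S j e'
    no-covering-llr-j e' e≤e' llr = not-covered-j e' llr (j≤x , x≤y , ≤-trans y≤e e≤e')
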